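{- Let $\bar x$ be a vector of variables and $\alpha$ a solved basic formula. Let $\bar x'$ be the variables of $\bar x$ that are reachable in $\exists\bar x\,.\,\alpha$, and let $\alpha'$ be the conjunction of the equations and $\mathrm{fin}$-formulae of $\alpha$ that are reachable in $\exists\bar x\,.\,\alpha$. Then $\exists\bar x\,.\,\alpha$ is equivalent to $\exists\bar x'\,.\,\alpha'$ in the structure $\mathcal T$ of trees.
   Context: Signature and trees: sorts $S$, generators $g: s_1\times\cdots\times s_n\to s$ with $F_s$ the nonempty set of generators of $s$, every sort having at least two generators; predicates $\mathrm{fin}_s$. $\mathcal T$ interprets each sort as the set of (possibly infinite) rooted ordered generator-labeled trees of that sort, generators as tree-building, and $\mathrm{fin}$ as finiteness. A basic formula is $(\bigwedge_i v_i=t_i)\wedge(\bigwedge_j\mathrm{fin}(u_j))$ with each $t_i$ a variable or $g(\bar z)$, $\bar z$ variables; it is solved (w.r.t. a total order on its variables) if all $v_i,u_j$ are pairwise distinct, $x>y$ for each equation $x=y$ between variables, and $\mathrm{fin}(w)$ occurs only if the sort of $w$ contains both finite and infinite trees. In a basic formula, $x_n$ is reachable from $x_0$ if it contains $x_0=t_0\wedge\cdots\wedge x_{n-1}=t_{n-1}$ with each $t_i$ containing $x_{i+1}$ ($n\ge0$). Reachability in $\exists\bar x\,.\,\alpha$ means reachability in $\alpha$ from the free variables of $\exists\bar x\,.\,\alpha$; an equation $u=t$ or formula $\mathrm{fin}(u)$ is reachable if $u$ is. -}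

module Defs where

open import Data.Nat using (ℕ; _≤_; _<?_)
open import Data.Fin using (Fin; toℕ; fromℕ<)
open import Data.List using (List; []; _∷_; _++_; [_])
open import Data.List.Membership.Propositional using (_∈_)
open import Data.List.Relation.Unary.Unique.Propositional using (Unique)
open import Data.Maybe using (Maybe; just; nothing)
open import Data.Product using (Σ; _×_; _,_; proj₁)
open import Data.Sum using (_⊎_)
open import Relation.Nullary using (¬_; yes; no)
open import Relation.Binary.PropositionalEquality using (_≡_; _≢_)
open import Relation.Binary using (IsStrictTotalOrder)

record Signature : Set₁ where
  field
    Sort    : Set
    Gen     : Set
    sortOf  : Gen → Sort
    arity   : Gen → ℕ
    argSort : (g : Gen) → Fin (arity g) → Sort

TwoGens : Signature → Set
TwoGens Sg = ∀ s → Σ Gen λ g₁ → Σ Gen λ g₂ →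
               g₁ ≢ g₂ × sortOf g₁ ≡ s × sortOf g₂ ≡ s
  where open Signature Sg

record Vars (Sg : Signature) : Set₁ where
  open Signature Sg
  field
    V      : Set
    sortV  : V → Sort
    _≺_    : V → V → Set
    isSTO  : IsStrictTotalOrder _≡_ _≺_

module _ (Sg : Signature) where
  open Signature Sg

  -- Possibly infinite rooted ordered generator-labelled trees of sort s,
  -- represented by their labelling of positions (paths from the root,
  -- a path being the list of child indices).  'nothing' = no node there.

  record Tree (s : Sort) : Set where
    field
      node    : List ℕ → Maybe Gen
      rootOk  : Σ Gen λ g → node [] ≡ just g × sortOf g ≡ s
      childOk : ∀ p g → node p ≡ just g →
                  (∀ (i : Fin (arity g)) → Σ Gen λ g′ →
                      node (p ++ [ toℕ i ]) ≡ just g′ × sortOf g′ ≡ argSort g i)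
                × (∀ i → arity g ≤ i → node (p ++ [ i ]) ≡ nothing)
      closed  : ∀ p i → node p ≡ nothing → node (p ++ [ i ]) ≡ nothing
  open Tree public

  _≈T_ : ∀ {s t} → Tree s → Tree t → Set
  a ≈T b = ∀ p → node a p ≡ node b p

  build : (g : Gen) → (Fin (arity g) → List ℕ → Maybe Gen) → List ℕ → Maybe Gen
  build g ch [] = just g
  build g ch (i ∷ p) with i <? arity g
  ... | yes h = ch (fromℕ< h) p
  ... | no _  = nothing

  data FinTree : Set where
    mk : (g : Gen) → (Fin (arity g) → FinTree) → FinTree

  finNode : FinTree → List ℕ → Maybe Gen
  finNode (mk g cs) = build g (λ i → finNode (cs i))

  IsFinite : ∀ {s} → Tree s → Set
  IsFinite t = Σ FinTree λ f → ∀ p → finNode f p ≡ node t p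

  MixedSort : Sort → Set
  MixedSort s = (Σ (Tree s) IsFinite) × (Σ (Tree s) λ t → ¬ IsFinite t)

  module _ (VS : Vars Sg) where
    open Vars VS

    data Term (s : Sort) : Set where
      var : (w : V) → sortV w ≡ s → Term s
      app : (g : Gen) → sortOf g ≡ s →
            (zs : Fin (arity g) → V) → (∀ i → sortV (zs i) ≡ argSort g i) → Term s

    Equation : Set
    Equation = Σ V λ v → Term (sortV v)

    record Basic : Set where
      field
        eqs  : List Equation
        fins : List V
    open Basic public

    lhs : Equation → V
    lhs = proj₁

    Solved : Basic → Set
    Solved α =
        Unique (Data.List.map lhs (eqs α) ++ fins α)
      × (∀ x y (p : sortV y ≡ sortV x) → (x , var y p) ∈ eqs α → y ≺ x)
      × (∀ w → w ∈ fins α → MixedSort (sortV w))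

    OccursT : ∀ {s} → V → Term s → Set
    OccursT y (var w _)      = y ≡ w
    OccursT y (app _ _ zs _) = Σ (Fin _) λ i → zs i ≡ y

    OccursIn : V → Basic → Set
    OccursIn y α = (Σ Equation λ e → e ∈ eqs α × (y ≡ lhs e ⊎ OccursT y (Data.Product.proj₂ e)))
                 ⊎ y ∈ fins α

    Free : List V → Basic → V → Set
    Free xs α y = OccursIn y α × ¬ (y ∈ xs)

    data Reach (α : Basic) : V → V → Set where
      here : ∀ {x} → Reach α x x
      step : ∀ {x y z} (t : Term (sortV x)) → (x , t) ∈ eqs α →
             OccursT y t → Reach α y z → Reach α x z

    Reachable : List V → Basic → V → Set
    Reachable xs α y = Σ V λ u → Free xs α u × Reach α u y

    Valuation : Set
    Valuation = (v : V) → Tree (sortV v)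

    SatT : Valuation → (v : V) → ∀ {s} → Term s → Set
    SatT ρ v (var w _)      = ρ v ≈T ρ w
    SatT ρ v (app g _ zs _) = ∀ p → node (ρ v) p ≡ build g (λ i → node (ρ (zs i))) p

    -- Truth of the conjunction of those atoms of α (equations v = t and
    -- fin(u)) whose left variable satisfies P.  P = everything gives α.
    SatSel : Valuation → Basic → (V → Set) → Set
    SatSel ρ α P =
        (∀ e → e ∈ eqs α → P (lhs e) → SatT ρ (lhs e) (Data.Product.proj₂ e))
      × (∀ u → u ∈ fins α → P u → IsFinite (ρ u))

    Exists : (V → Set) → (Valuation → Set) → Valuation → Set
    Exists B φ ρ = Σ Valuation λ ρ′ → (∀ v → ¬ B v → ρ′ v ≈T ρ v) × φ ρ′

-- A valuation satisfying α restricts to one satisfying the reachable atoms,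
-- since these only mention reachable variables.  Conversely, every variable
-- that occurs in α but is unreachable is bound, so it may be redefined: an
-- unreachable fin(u) gets a finite tree (its sort has one), and the unreachable
-- equations, a solved system in their own right, are solved on top.  Following
-- the strictly descending variable equations x = y from any variable ends in an
-- application or an unconstrained variable, and the solution trees are unfolded
-- from these heads position by position.

module Submission where

open import Defs
open import Data.Empty using (⊥-elim)
open import Data.Fin using (Fin; toℕ; fromℕ<)
open import Data.Fin.Properties using (toℕ<n; fromℕ<-toℕ)
import Data.Fin.Properties as Fin
open import Data.List using (List; []; _∷_; _++_; [_]; length; map; filter)
open import Data.List.Properties using (filter-notAll)
open import Data.List.Membership.Propositional using (_∈_; _∉_; find; lose)
open import Data.List.Membership.Propositional.Properties using (∈-map⁺; ∈-filter⁺; ∈-filter⁻)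
import Data.List.Membership.DecPropositional as DecMembership
open import Data.List.Relation.Unary.Any using (here; there; any?)
import Data.List.Relation.Unary.All as All
import Data.List.Relation.Unary.All.Properties as All
open import Data.List.Relation.Unary.AllPairs using ([]; _∷_)
open import Data.List.Relation.Unary.Unique.Propositional using (Unique)
open import Data.Maybe using (Maybe; just; nothing)
open import Data.Nat using (ℕ; zero; suc; _≤_; _<_; _<?_)
open import Data.Nat.Properties using (≤-refl; ≤-pred; <-≤-trans; <⇒≱)
open import Data.Product using (Σ; _×_; _,_; proj₁; proj₂)
open import Data.Sum using (_⊎_; inj₁; inj₂)
open import Data.Unit using (⊤; tt)
open import Relation.Binary using (IsStrictTotalOrder)
open import Relation.Binary.PropositionalEquality using (_≡_; refl; sym; trans; cong; subst)
open import Relation.Nullary using (¬_; Dec; yes; no)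
open import Relation.Nullary.Decidable using (map′; ¬?; _×-dec_; _⊎-dec_)

any∈? : {A : Set} {P : A → Set} → (∀ a → Dec (P a)) → ∀ xs → Dec (Σ A λ a → a ∈ xs × P a)
any∈? P? xs = map′ find (λ (_ , a∈xs , pa) → lose a∈xs pa) (any? P? xs)

unique-++⁻ : {A : Set} (xs : List A) {ys : List A} →
             Unique (xs ++ ys) → Unique xs × (∀ {v} → v ∈ xs → v ∉ ys)
unique-++⁻ []       _           = [] , λ ()
unique-++⁻ (x ∷ xs) (x∉ ∷ uniq) =
  All.++⁻ˡ xs x∉ ∷ proj₁ (unique-++⁻ xs uniq) ,
  λ { (here refl) x∈ys → All.lookup (All.++⁻ʳ xs x∉) x∈ys refl
    ; (there v∈xs)     → proj₂ (unique-++⁻ xs uniq) v∈xs }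

unique-map⇒injective : {A B : Set} (f : A → B) {xs : List A} → Unique (map f xs) →
                       ∀ {x y} → x ∈ xs → y ∈ xs → f x ≡ f y → x ≡ y
unique-map⇒injective f (_   ∷ _)    (here refl) (here refl) _     = refl
unique-map⇒injective f (fx∉ ∷ _)    (here refl) (there y∈)  fx≡fy =
  ⊥-elim (All.lookup fx∉ (∈-map⁺ f y∈) fx≡fy)
unique-map⇒injective f (fy∉ ∷ _)    (there x∈)  (here refl) fx≡fy =
  ⊥-elim (All.lookup fy∉ (∈-map⁺ f x∈) (sym fx≡fy))
unique-map⇒injective f (_   ∷ uniq) (there x∈)  (there y∈)  fx≡fy =
  unique-map⇒injective f uniq x∈ y∈ fx≡fy

module _ (Sg : Signature) where
  open Signature Sg

  _≈_ : ∀ {s t} → Tree Sg s → Tree Sg t → Set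
  _≈_ = _≈T_ Sg

  build-cong : ∀ g {c c′ : Fin (arity g) → List ℕ → Maybe Gen} →
               (∀ i p → c i p ≡ c′ i p) → ∀ p → build Sg g c p ≡ build Sg g c′ p
  build-cong g c≗c′ []      = refl
  build-cong g c≗c′ (i ∷ p) with i <? arity g
  ... | yes i< = c≗c′ (fromℕ< i<) p
  ... | no _   = refl

  isFinite-resp : ∀ {s} {a b : Tree Sg s} → a ≈ b → IsFinite Sg a → IsFinite Sg b
  isFinite-resp a≈b (f , f≗a) = f , λ p → trans (f≗a p) (a≈b p)

  module _ (VS : Vars Sg) where
    open Vars VS
    open IsStrictTotalOrder isSTO using (_≟_; irrefl) renaming (trans to ≺-trans)
    open DecMembership _≟_ using (_∈?_)

    private
      Tm : Sort → Set
      Tm = Term Sg VS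

      Eqn : Set
      Eqn = Equation Sg VS

      Val : Set
      Val = Valuation Sg VS

    satT-resp : ∀ {ρ₁ ρ₂ : Val} x {s} (t : Tm s) →
                (∀ z → z ≡ x ⊎ OccursT Sg VS z t → ρ₁ z ≈ ρ₂ z) →
                SatT Sg VS ρ₁ x t → SatT Sg VS ρ₂ x t
    satT-resp x (var w _) ρ₁≈ρ₂ sat p =
      trans (sym (ρ₁≈ρ₂ x (inj₁ refl) p)) (trans (sat p) (ρ₁≈ρ₂ w (inj₂ refl) p))
    satT-resp x (app g _ zs _) ρ₁≈ρ₂ sat p =
      trans (sym (ρ₁≈ρ₂ x (inj₁ refl) p))
            (trans (sat p) (build-cong g (λ i → ρ₁≈ρ₂ (zs i) (inj₂ (i , refl))) p))

    occursT? : ∀ y {s} (t : Tm s) → Dec (OccursT Sg VS y t)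
    occursT? y (var w _)      = y ≟ w
    occursT? y (app _ _ zs _) = Fin.any? (λ i → zs i ≟ y)

    anyOccurrence? : {P : V → Set} → (∀ z → Dec (P z)) →
                     ∀ {s} (t : Tm s) → Dec (Σ V λ z → OccursT Sg VS z t × P z)
    anyOccurrence? P? (var w _) =
      map′ (λ pw → w , refl , pw) (λ { (_ , refl , pw) → pw }) (P? w)
    anyOccurrence? P? (app _ _ zs _) =
      map′ (λ (i , pz) → zs i , (i , refl) , pz) (λ { (_ , (i , refl) , pz) → i , pz })
           (Fin.any? (λ i → P? (zs i)))

    reach-++ : ∀ {β u v w} → Reach Sg VS β u v → Reach Sg VS β v w → Reach Sg VS β u w
    reach-++ here             r′ = r′
    reach-++ (step t e∈ o r) r′ = step t e∈ o (reach-++ r r′)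

    reach-mono : ∀ {β β′ u v} → (∀ {e} → e ∈ eqs β → e ∈ eqs β′) →
                 Reach Sg VS β u v → Reach Sg VS β′ u v
    reach-mono β⊆β′ here            = here
    reach-mono β⊆β′ (step t e∈ o r) = step t (β⊆β′ e∈) o (reach-mono β⊆β′ r)

    _⊢_↝_ : List Eqn → V → V → Set
    E ⊢ u ↝ v = Reach Sg VS (record { eqs = E ; fins = [] }) u v

    -- Cut a path at its last use of the first equation: before it the path
    -- reaches x, after it the path never uses that equation again.
    ↝-∷⁻ : ∀ {E x} {t : Tm (sortV x)} {u v} → ((x , t) ∷ E) ⊢ u ↝ v →
           E ⊢ u ↝ v ⊎ (E ⊢ u ↝ x × Σ V λ z → OccursT Sg VS z t × E ⊢ z ↝ v)
    ↝-∷⁻ here = inj₁ here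
    ↝-∷⁻ (step _ (here refl) o r) with ↝-∷⁻ r
    ... | inj₁ r′                = inj₂ (here , _ , o , r′)
    ... | inj₂ (_ , z , o′ , r′) = inj₂ (here , z , o′ , r′)
    ↝-∷⁻ (step t (there e∈) o r) with ↝-∷⁻ r
    ... | inj₁ r′                 = inj₁ (step t e∈ o r′)
    ... | inj₂ (r₁ , z , o′ , r₂) = inj₂ (step t e∈ o r₁ , z , o′ , r₂)

    ↝-∷⁺ : ∀ {E x} {t : Tm (sortV x)} {u v} →
           E ⊢ u ↝ v ⊎ (E ⊢ u ↝ x × Σ V λ z → OccursT Sg VS z t × E ⊢ z ↝ v) →
           ((x , t) ∷ E) ⊢ u ↝ v
    ↝-∷⁺ (inj₁ r)                = reach-mono there r
    ↝-∷⁺ (inj₂ (r₁ , _ , o , r₂)) =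
      reach-++ (reach-mono there r₁) (step _ (here refl) o (reach-mono there r₂))

    ↝? : ∀ E u v → Dec (E ⊢ u ↝ v)
    ↝? [] u v = map′ (λ { refl → here }) (λ { here → refl ; (step _ () _ _) }) (u ≟ v)
    ↝? ((x , t) ∷ E) u v =
      map′ ↝-∷⁺ ↝-∷⁻ (↝? E u v ⊎-dec (↝? E u x ×-dec anyOccurrence? (λ z → ↝? E z v) t))

    reach? : ∀ β u v → Dec (Reach Sg VS β u v)
    reach? β u v = map′ (reach-mono (λ e∈ → e∈)) (reach-mono (λ e∈ → e∈)) (↝? (eqs β) u v)

    -- A head var w stands for the parameter tree ρ₀ w, not for the unfolding at w.
    module Unfolding (ρ₀ : Val) (head : (x : V) → Tm (sortV x)) where
      mutual
        nodeAt : V → List ℕ → Maybe Gen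
        nodeAt x p = termNode (head x) p

        termNode : ∀ {s} → Tm s → List ℕ → Maybe Gen
        termNode (var w _)      p       = node (ρ₀ w) p
        termNode (app g _ _ _)  []      = just g
        termNode (app g _ zs _) (i ∷ p) = childNode g zs p (i <? arity g)

        childNode : ∀ g → (Fin (arity g) → V) → List ℕ → ∀ {i} → Dec (i < arity g) → Maybe Gen
        childNode g zs p (yes i<) = nodeAt (zs (fromℕ< i<)) p
        childNode g zs p (no _)   = nothing

      termNode-root : ∀ {s} (t : Tm s) → Σ Gen λ g → termNode t [] ≡ just g × sortOf g ≡ s
      termNode-root (var w w≡s) with rootOk (ρ₀ w)
      ... | g , root≡g , g≡w = g , root≡g , trans g≡w w≡s
      termNode-root (app g g≡s _ _) = g , refl , g≡s

      termNode-closed : ∀ {s} (t : Tm s) p i → termNode t p ≡ nothing → termNode t (p ++ [ i ]) ≡ nothing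
      termNode-closed (var w _)      p       i = closed (ρ₀ w) p i
      termNode-closed (app g _ zs _) (j ∷ p) i p↦nothing with j <? arity g
      ... | yes j< = termNode-closed (head (zs (fromℕ< j<))) p i p↦nothing
      ... | no _   = refl

      termNode-children : ∀ {s} (t : Tm s) p g → termNode t p ≡ just g →
          (∀ (i : Fin (arity g)) → Σ Gen λ g′ →
             termNode t (p ++ [ toℕ i ]) ≡ just g′ × sortOf g′ ≡ argSort g i)
        × (∀ i → arity g ≤ i → termNode t (p ++ [ i ]) ≡ nothing)
      termNode-children (var w _) = childOk (ρ₀ w)
      termNode-children (app g _ zs zs-sort) [] .g refl = child , beyond
        where
          child : ∀ i → Σ Gen λ g′ →
                  childNode g zs [] (toℕ i <? arity g) ≡ just g′ × sortOf g′ ≡ argSort g i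
          child i with toℕ i <? arity g
          ... | no i≮ = ⊥-elim (i≮ (toℕ<n i))
          ... | yes i< with termNode-root (head (zs (fromℕ< i<)))
          ...   | g′ , root≡g′ , g′≡zs =
                  g′ , root≡g′ ,
                  trans g′≡zs (trans (zs-sort (fromℕ< i<)) (cong (argSort g) (fromℕ<-toℕ i i<)))

          beyond : ∀ i → arity g ≤ i → childNode g zs [] (i <? arity g) ≡ nothing
          beyond i g≤i with i <? arity g
          ... | yes i< = ⊥-elim (<⇒≱ i< g≤i)
          ... | no _   = refl
      termNode-children (app g′ _ zs _) (j ∷ p) g p↦g with j <? arity g′
      termNode-children (app g′ _ zs _) (j ∷ p) g p↦g  | yes j< =
        termNode-children (head (zs (fromℕ< j<))) p g p↦g
      termNode-children (app g′ _ zs _) (j ∷ p) g ()   | no _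

      unfold : Val
      unfold x = record
        { node    = nodeAt x
        ; rootOk  = termNode-root (head x)
        ; childOk = termNode-children (head x)
        ; closed  = termNode-closed (head x)
        }

      termNode-app : ∀ {s} g (g≡s : sortOf g ≡ s) zs zs-sort p →
                     termNode (app g g≡s zs zs-sort) p ≡ build Sg g (λ i → node (unfold (zs i))) p
      termNode-app g _ _ _ []      = refl
      termNode-app g _ _ _ (i ∷ p) with i <? arity g
      ... | yes _ = refl
      ... | no _  = refl

      termNode-subst : ∀ {s s′} (s≡s′ : s ≡ s′) (t : Tm s) p →
                       termNode (subst Tm s≡s′ t) p ≡ termNode t p
      termNode-subst refl t p = refl

    UniqueLhs : List Eqn → Set
    UniqueLhs E = ∀ {e f} → e ∈ E → f ∈ E → proj₁ e ≡ proj₁ f → e ≡ f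

    Descending : List Eqn → Set
    Descending E = ∀ x y (p : sortV y ≡ sortV x) → (x , var y p) ∈ E → y ≺ x

    data Resolves (E : List Eqn) : (x : V) → Tm (sortV x) → Set where
      unbound   : ∀ {x} → (∀ t → (x , t) ∉ E) → Resolves E x (var x refl)
      bound-app : ∀ {x g q zs r} → (x , app g q zs r) ∈ E → Resolves E x (app g q zs r)
      bound-var : ∀ {x y p t} → (x , var y p) ∈ E → Resolves E y t → Resolves E x (subst Tm p t)

    resolves-unique : ∀ {E x t t′} → UniqueLhs E → Resolves E x t → Resolves E x t′ → t ≡ t′
    resolves-unique uniq (unbound _)      (unbound _)      = refl
    resolves-unique uniq (unbound free)   (bound-app e∈)   = ⊥-elim (free _ e∈)
    resolves-unique uniq (unbound free)   (bound-var e∈ _) = ⊥-elim (free _ e∈)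
    resolves-unique uniq (bound-app e∈)   (unbound free)   = ⊥-elim (free _ e∈)
    resolves-unique uniq (bound-var e∈ _) (unbound free)   = ⊥-elim (free _ e∈)
    resolves-unique uniq (bound-app e∈)   (bound-app f∈)   with uniq e∈ f∈ refl
    ... | refl = refl
    resolves-unique uniq (bound-app e∈)   (bound-var f∈ _) with uniq e∈ f∈ refl
    ... | ()
    resolves-unique uniq (bound-var e∈ _) (bound-app f∈)   with uniq e∈ f∈ refl
    ... | ()
    resolves-unique uniq (bound-var {p = p} e∈ d) (bound-var f∈ d′) with uniq e∈ f∈ refl
    ... | refl = cong (subst Tm p) (resolves-unique uniq d d′)

    without : V → List Eqn → List Eqn
    without x = filter (λ e → ¬? (proj₁ e ≟ x))

    resolves-without : ∀ {E x z t} → Descending E → z ≺ x → Resolves (without x E) z t → Resolves E z t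
    resolves-without desc z≺x (unbound free) =
      unbound λ t e∈ → free t (∈-filter⁺ (λ e → ¬? (proj₁ e ≟ _)) e∈ λ z≡x → irrefl z≡x z≺x)
    resolves-without desc z≺x (bound-app e∈) = bound-app (proj₁ (∈-filter⁻ _ e∈))
    resolves-without {E} {z = z} desc z≺x (bound-var {y = y} {p} e∈ d) =
      bound-var e∈′ (resolves-without desc (≺-trans (desc _ _ _ e∈′) z≺x) d)
      where
        e∈′ : (z , var y p) ∈ E
        e∈′ = proj₁ (∈-filter⁻ _ e∈)

    -- Resolving y ≺ x never needs the equations for x (resolves-without), so
    -- they are dropped; hence length E is enough fuel.
    resolves-exists : ∀ n {E} → length E ≤ n → Descending E → ∀ x → Σ (Tm (sortV x)) (Resolves E x)
    resolves-exists zero {[]} _ _ x = var x refl , unbound λ _ ()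
    resolves-exists (suc n) {E} |E|≤ desc x with any∈? (λ e → proj₁ e ≟ x) E
    ... | no ¬bound = var x refl , unbound λ t e∈ → ¬bound (_ , e∈ , refl)
    ... | yes ((_ , app g q zs r) , e∈ , refl) = app g q zs r , bound-app e∈
    ... | yes ((_ , var y p) , e∈ , refl) with resolves-exists n |E′|≤n desc′ y
      where
        |E′|≤n : length (without x E) ≤ n
        |E′|≤n = ≤-pred (<-≤-trans (filter-notAll _ E (lose e∈ λ x≢x → x≢x refl)) |E|≤)
        desc′ : Descending (without x E)
        desc′ u v q e∈′ = desc u v q (proj₁ (∈-filter⁻ _ e∈′))
    ...   | t , d = subst Tm p t , bound-var e∈ (resolves-without desc (desc _ y p e∈) d)

    IsSolution : List Eqn → Val → Val → Set
    IsSolution E ρ₀ ρ = (∀ e → e ∈ E → SatT Sg VS ρ (proj₁ e) (proj₂ e))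
                      × (∀ x → (∀ t → (x , t) ∉ E) → ρ x ≈ ρ₀ x)

    solvable : ∀ E → UniqueLhs E → Descending E → (ρ₀ : Val) → Σ Val (IsSolution E ρ₀)
    solvable E uniq desc ρ₀ = unfold , satisfies , fixes-unbound
      where
        resolution : ∀ x → Σ (Tm (sortV x)) (Resolves E x)
        resolution = resolves-exists (length E) ≤-refl desc

        open Unfolding ρ₀ (λ x → proj₁ (resolution x))

        resolved : ∀ {x t} → Resolves E x t → ∀ p → nodeAt x p ≡ termNode t p
        resolved d p = cong (λ t → termNode t p) (resolves-unique uniq (proj₂ (resolution _)) d)

        satisfies : ∀ e → e ∈ E → SatT Sg VS unfold (proj₁ e) (proj₂ e)
        satisfies (x , var y p) e∈ q =
          trans (resolved (bound-var e∈ (proj₂ (resolution y))) q) (termNode-subst p _ q)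
        satisfies (x , app g g≡ zs zs-sort) e∈ q =
          trans (resolved (bound-app e∈) q) (termNode-app g g≡ zs zs-sort q)

        fixes-unbound : ∀ x → (∀ t → (x , t) ∉ E) → unfold x ≈ ρ₀ x
        fixes-unbound x free = resolved (unbound free)

    module _ (xs : List V) (α : Basic Sg VS) where
      private
        R : V → Set
        R = Reachable Sg VS xs α

      Holds∃α : Val → Set
      Holds∃α = Exists Sg VS (λ v → v ∈ xs) (λ ρ′ → SatSel Sg VS ρ′ α (λ _ → ⊤))

      Holds∃α′ : Val → Set
      Holds∃α′ = Exists Sg VS (λ v → v ∈ xs × R v) (λ ρ′ → SatSel Sg VS ρ′ α R)

      occursIn? : ∀ y → Dec (OccursIn Sg VS y α)
      occursIn? y = any∈? (λ e → y ≟ proj₁ e ⊎-dec occursT? y (proj₂ e)) (eqs α) ⊎-dec y ∈? fins α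

      -- A path from a free variable either is empty or starts with an
      -- equation, whose left-hand side is then itself free.
      reachable? : ∀ y → Dec (R y)
      reachable? y =
        map′ fromFree toFree
             ((occursIn? y ×-dec ¬? (y ∈? xs)) ⊎-dec
              any∈? (λ e → ¬? (proj₁ e ∈? xs) ×-dec reach? α (proj₁ e) y) (eqs α))
        where
          FreeOrFromFreeLhs : Set
          FreeOrFromFreeLhs =
            Free Sg VS xs α y ⊎ (Σ Eqn λ e → e ∈ eqs α × proj₁ e ∉ xs × Reach Sg VS α (proj₁ e) y)

          fromFree : FreeOrFromFreeLhs → R y
          fromFree (inj₁ y-free)                     = y , y-free , here
          fromFree (inj₂ ((u , t) , e∈ , u∉ , u↝y)) = u , (inj₁ ((u , t) , e∈ , inj₁ refl) , u∉) , u↝y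

          toFree : R y → FreeOrFromFreeLhs
          toFree (_ , y-free , here)              = inj₁ y-free
          toFree (u , (_ , u∉) , step t e∈ o r) = inj₂ ((u , t) , e∈ , u∉ , step t e∈ o r)

      reachable-step : ∀ {x z} {t : Tm (sortV x)} → R x → (x , t) ∈ eqs α → OccursT Sg VS z t → R z
      reachable-step (u , u-free , u↝x) e∈ o = u , u-free , reach-++ u↝x (step _ e∈ o here)

      satReachable-resp : ∀ {ρ₁ ρ₂ : Val} → (∀ v → R v → ρ₁ v ≈ ρ₂ v) →
                          SatSel Sg VS ρ₁ α R → SatSel Sg VS ρ₂ α R
      satReachable-resp {ρ₁} {ρ₂} ρ₁≈ρ₂ (sat-eqs , sat-fins) =
        (λ { (x , t) e∈ rx → satT-resp x t (agree rx e∈) (sat-eqs (x , t) e∈ rx) }) ,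
        (λ u u∈ ru → isFinite-resp {a = ρ₁ u} {b = ρ₂ u} (ρ₁≈ρ₂ u ru) (sat-fins u u∈ ru))
        where
          agree : ∀ {x} {t : Tm (sortV x)} → R x → (x , t) ∈ eqs α →
                  ∀ z → z ≡ x ⊎ OccursT Sg VS z t → ρ₁ z ≈ ρ₂ z
          agree rx e∈ z (inj₁ refl) = ρ₁≈ρ₂ z rx
          agree rx e∈ z (inj₂ o)    = ρ₁≈ρ₂ z (reachable-step rx e∈ o)

      restrict-to-reachable : ∀ ρ → Holds∃α ρ → Holds∃α′ ρ
      restrict-to-reachable ρ (ρ′ , ρ′≈ρ , sat-eqs , sat-fins) =
        ρ″ , ρ″≈ρ ,
        satReachable-resp ρ′≈ρ″ ((λ e e∈ _ → sat-eqs e e∈ tt) , (λ u u∈ _ → sat-fins u u∈ tt))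
        where
          ρ″ : Val
          ρ″ v with reachable? v
          ... | yes _ = ρ′ v
          ... | no _  = ρ v

          ρ′≈ρ″ : ∀ v → R v → ρ′ v ≈ ρ″ v
          ρ′≈ρ″ v rv with reachable? v
          ... | yes _  = λ _ → refl
          ... | no ¬rv = ⊥-elim (¬rv rv)

          ρ″≈ρ : ∀ v → ¬ (v ∈ xs × R v) → ρ″ v ≈ ρ v
          ρ″≈ρ v ¬bound with reachable? v
          ... | yes rv = ρ′≈ρ v λ v∈xs → ¬bound (v∈xs , rv)
          ... | no _   = λ _ → refl

      module _ (sol : Solved Sg VS α) where
        private
          lhs-unique : UniqueLhs (eqs α)
          lhs-unique = unique-map⇒injective proj₁ (proj₁ (unique-++⁻ (map proj₁ (eqs α)) (proj₁ sol)))

          bound∉fins : ∀ {x} {t : Tm (sortV x)} → (x , t) ∈ eqs α → x ∉ fins α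
          bound∉fins e∈ = proj₂ (unique-++⁻ (map proj₁ (eqs α)) (proj₁ sol)) (∈-map⁺ proj₁ e∈)

          unreachable-lhs? : (e : Eqn) → Dec (¬ R (proj₁ e))
          unreachable-lhs? e = ¬? (reachable? (proj₁ e))

          unreachable : List Eqn
          unreachable = filter unreachable-lhs? (eqs α)

          unreachable⊆ : ∀ {e} → e ∈ unreachable → e ∈ eqs α × ¬ R (proj₁ e)
          unreachable⊆ = ∈-filter⁻ unreachable-lhs?

        extend-to-unreachable : ∀ ρ → Holds∃α′ ρ → Holds∃α ρ
        extend-to-unreachable ρ (ρ″ , ρ″≈ρ , sat) = ρ′ , ρ′≈ρ , sat-eqs , sat-fins
          where
            ρ₀ : Val
            ρ₀ v with ¬? (reachable? v) ×-dec v ∈? fins α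
            ... | yes (_ , v∈) = proj₁ (proj₁ (proj₂ (proj₂ sol) v v∈))
            ... | no _         = ρ″ v

            ρ₀-finite : ∀ u → ¬ R u → u ∈ fins α → IsFinite Sg (ρ₀ u)
            ρ₀-finite u ¬ru u∈ with ¬? (reachable? u) ×-dec u ∈? fins α
            ... | yes (_ , u∈′) = proj₂ (proj₁ (proj₂ (proj₂ sol) u u∈′))
            ... | no ¬fin       = ⊥-elim (¬fin (¬ru , u∈))

            ρ₀≈ρ″ : ∀ v → ¬ (¬ R v × v ∈ fins α) → ρ₀ v ≈ ρ″ v
            ρ₀≈ρ″ v ¬fin with ¬? (reachable? v) ×-dec v ∈? fins α
            ... | yes fin = ⊥-elim (¬fin fin)
            ... | no _    = λ _ → refl

            solution : Σ Val (IsSolution unreachable ρ₀)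
            solution = solvable unreachable
                         (λ e∈ f∈ → lhs-unique (proj₁ (unreachable⊆ e∈)) (proj₁ (unreachable⊆ f∈)))
                         (λ x y p e∈ → proj₁ (proj₂ sol) x y p (proj₁ (unreachable⊆ e∈)))
                         ρ₀

            ρ′ : Val
            ρ′ = proj₁ solution

            ρ′≈ρ₀ : ∀ v → (∀ t → (v , t) ∉ unreachable) → ρ′ v ≈ ρ₀ v
            ρ′≈ρ₀ = proj₂ (proj₂ solution)

            ρ′≈ρ″ : ∀ v → R v ⊎ ¬ OccursIn Sg VS v α → ρ′ v ≈ ρ″ v
            ρ′≈ρ″ v (inj₁ rv) p =
              trans (ρ′≈ρ₀ v (λ t e∈ → proj₂ (unreachable⊆ e∈) rv) p)
                    (ρ₀≈ρ″ v (λ (¬rv , _) → ¬rv rv) p)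
            ρ′≈ρ″ v (inj₂ ¬occ) p =
              trans (ρ′≈ρ₀ v (λ t e∈ → ¬occ (inj₁ (_ , proj₁ (unreachable⊆ e∈) , inj₁ refl))) p)
                    (ρ₀≈ρ″ v (λ (_ , v∈) → ¬occ (inj₂ v∈)) p)

            ρ′≈ρ : ∀ v → v ∉ xs → ρ′ v ≈ ρ v
            ρ′≈ρ v v∉ p = trans (ρ′≈ρ″ v kept p) (ρ″≈ρ v (λ (v∈ , _) → v∉ v∈) p)
              where
                kept : R v ⊎ ¬ OccursIn Sg VS v α
                kept with occursIn? v
                ... | yes occ = inj₁ (v , (occ , v∉) , here)
                ... | no ¬occ = inj₂ ¬occ

            satR : SatSel Sg VS ρ′ α R
            satR = satReachable-resp (λ v rv p → sym (ρ′≈ρ″ v (inj₁ rv) p)) sat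

            sat-eqs : ∀ e → e ∈ eqs α → ⊤ → SatT Sg VS ρ′ (proj₁ e) (proj₂ e)
            sat-eqs e e∈ _ with reachable? (proj₁ e)
            ... | yes re = proj₁ satR e e∈ re
            ... | no ¬re = proj₁ (proj₂ solution) e (∈-filter⁺ unreachable-lhs? e∈ ¬re)

            sat-fins : ∀ u → u ∈ fins α → ⊤ → IsFinite Sg (ρ′ u)
            sat-fins u u∈ _ with reachable? u
            ... | yes ru = proj₂ satR u u∈ ru
            ... | no ¬ru =
              isFinite-resp {a = ρ₀ u} {b = ρ′ u} (λ p → sym (ρ′≈ρ₀ u unbound-u p)) (ρ₀-finite u ¬ru u∈)
              where
                unbound-u : ∀ t → (u , t) ∉ unreachable
                unbound-u t e∈ = bound∉fins (proj₁ (unreachable⊆ e∈)) u∈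

lemma12 : (Sg : Signature) → TwoGens Sg → (VS : Vars Sg) →
          (xs : List (Vars.V VS)) → (α : Basic Sg VS) → Solved Sg VS α →
          (ρ : Valuation Sg VS) →
            (Exists Sg VS (λ v → v ∈ xs) (λ ρ′ → SatSel Sg VS ρ′ α (λ _ → ⊤)) ρ →
             Exists Sg VS (λ v → v ∈ xs × Reachable Sg VS xs α v)
               (λ ρ′ → SatSel Sg VS ρ′ α (Reachable Sg VS xs α)) ρ)
          × (Exists Sg VS (λ v → v ∈ xs × Reachable Sg VS xs α v)
               (λ ρ′ → SatSel Sg VS ρ′ α (Reachable Sg VS xs α)) ρ →
             Exists Sg VS (λ v → v ∈ xs) (λ ρ′ → SatSel Sg VS ρ′ α (λ _ → ⊤)) ρ)
lemma12 Sg _ VS xs α sol ρ =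
  restrict-to-reachable Sg VS xs α ρ , extend-to-unreachable Sg VS xs α sol ρ
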